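{- For any formula $\alpha$ and atom $a$, there exist a derivation from $\alpha$ to $[a\vee\alpha\{a/\mathsf f\}]$ using only the rules $\mathsf{aw}{\downarrow}$, $\mathsf{ac}{\downarrow}$, $\mathsf s$ (and $=$), and a derivation from $(a\wedge\alpha\{a/\mathsf t\})$ to $\alpha$ using only the rules $\mathsf{aw}{\uparrow}$, $\mathsf{ac}{\uparrow}$, $\mathsf s$ (and $=$), both of size cubic in $|\alpha|$.
   Context: Formulae are built from units $\mathsf t,\mathsf f$ and atoms (with a non-identical involution $a\mapsto\bar a$) by $[\alpha\vee\beta]$ and $(\alpha\wedge\beta)$. A context $\xi\{\ \}$ is a formula with a hole; a rule with premiss $\alpha$ and conclusion $\beta$ yields steps $\xi\{\gamma\}\to\xi\{\delta\}$ for instances $\gamma,\delta$ of $\alpha,\beta$ and any context. A derivation is a finite chain of steps. Rules: $\mathsf{aw}{\downarrow}$: $\mathsf f\to a$; $\mathsf{ac}{\downarrow}$: $[a\vee a]\to a$; $\mathsf{aw}{\uparrow}$: $a\to\mathsf t$; $\mathsf{ac}{\uparrow}$: $a\to(a\wedge a)$ (for atoms $a$); switch $\mathsf s$: $(\alpha\wedge[\beta\vee\gamma])\to[(\alpha\wedge\beta)\vee\gamma]$; the rule $=$ replaces a formula by one equal modulo associativity/commutativity of $\vee,\wedge$ and $[\alpha\vee\mathsf f]=\alpha$, $(\alpha\wedge\mathsf t)=\alpha$, $[\mathsf t\vee\mathsf t]=\mathsf t$, $(\mathsf f\wedge\mathsf f)=\mathsf f$, closed under contexts. $\alpha\{a/\beta\}$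 denotes the substitution of $\beta$ for all occurrences of the atom $a$ in $\alpha$ (occurrences of $\bar a$ are not affected). Size $|\cdot|$ = number of unit and atom occurrences. -}

module Defs where

open import Data.Nat using (ℕ; zero; suc; _+_; _*_; _^_; _≤_)
open import Data.Nat.Properties using (_≟_)
open import Data.Bool using (Bool; true; false; if_then_else_)
open import Relation.Nullary using (Dec; yes; no; ¬_)
open import Relation.Nullary.Decidable using (⌊_⌋)
open import Relation.Binary.PropositionalEquality using (_≡_; refl; cong)

data Atom : Set where
  pos : ℕ → Atom
  neg : ℕ → Atom

bar : Atom → Atom
bar (pos n) = neg n
bar (neg n) = pos n

_≟A_ : (a b : Atom) → Dec (a ≡ b)
pos m ≟A pos n with m ≟ n
... | yes refl = yes refl
... | no m≢n = no λ { refl → m≢n refl }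
pos m ≟A neg n = no λ ()
neg m ≟A pos n = no λ ()
neg m ≟A neg n with m ≟ n
... | yes refl = yes refl
... | no m≢n = no λ { refl → m≢n refl }

infixr 5 _∨_
infixr 6 _∧_

data Formula : Set where
  𝕥 𝕗 : Formula
  at  : Atom → Formula
  _∨_ : Formula → Formula → Formula
  _∧_ : Formula → Formula → Formula

size : Formula → ℕ
size 𝕥 = 1
size 𝕗 = 1
size (at _) = 1
size (α ∨ β) = size α + size β
size (α ∧ β) = size α + size β

-- α{a/β}: replace every occurrence of the atom a (not of ā) by β
subst : Formula → Atom → Formula → Formula
subst 𝕥 a β = 𝕥
subst 𝕗 a β = 𝕗
subst (at b) a β = if ⌊ b ≟A a ⌋ then β else at b
subst (α₁ ∨ α₂) a β = subst α₁ a β ∨ subst α₂ a β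
subst (α₁ ∧ α₂) a β = subst α₁ a β ∧ subst α₂ a β

data Context : Set where
  □    : Context
  _∨ₗ_ : Context → Formula → Context
  _∨ᵣ_ : Formula → Context → Context
  _∧ₗ_ : Context → Formula → Context
  _∧ᵣ_ : Formula → Context → Context

_⟦_⟧ : Context → Formula → Formula
□ ⟦ γ ⟧ = γ
(ξ ∨ₗ β) ⟦ γ ⟧ = ξ ⟦ γ ⟧ ∨ β
(β ∨ᵣ ξ) ⟦ γ ⟧ = β ∨ ξ ⟦ γ ⟧
(ξ ∧ₗ β) ⟦ γ ⟧ = ξ ⟦ γ ⟧ ∧ β
(β ∧ᵣ ξ) ⟦ γ ⟧ = β ∧ ξ ⟦ γ ⟧

infix 4 _≈_

data _≈_ : Formula → Formula → Set where
  ≈-refl  : ∀ {α} → α ≈ α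
  ≈-sym   : ∀ {α β} → α ≈ β → β ≈ α
  ≈-trans : ∀ {α β γ} → α ≈ β → β ≈ γ → α ≈ γ
  ∨-cong  : ∀ {α α' β β'} → α ≈ α' → β ≈ β' → (α ∨ β) ≈ (α' ∨ β')
  ∧-cong  : ∀ {α α' β β'} → α ≈ α' → β ≈ β' → (α ∧ β) ≈ (α' ∧ β')
  ∨-assoc : ∀ {α β γ} → ((α ∨ β) ∨ γ) ≈ (α ∨ (β ∨ γ))
  ∧-assoc : ∀ {α β γ} → ((α ∧ β) ∧ γ) ≈ (α ∧ (β ∧ γ))
  ∨-comm  : ∀ {α β} → (α ∨ β) ≈ (β ∨ α)
  ∧-comm  : ∀ {α β} → (α ∧ β) ≈ (β ∧ α)
  ∨-unit  : ∀ {α} → (α ∨ 𝕗) ≈ α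
  ∧-unit  : ∀ {α} → (α ∧ 𝕥) ≈ α
  tt      : (𝕥 ∨ 𝕥) ≈ 𝕥
  ff      : (𝕗 ∧ 𝕗) ≈ 𝕗

data DownRule : Formula → Formula → Set where
  aw↓ : ∀ a → DownRule 𝕗 (at a)
  ac↓ : ∀ a → DownRule (at a ∨ at a) (at a)
  s   : ∀ α β γ → DownRule (α ∧ (β ∨ γ)) ((α ∧ β) ∨ γ)
  eq  : ∀ {γ δ} → γ ≈ δ → DownRule γ δ

data UpRule : Formula → Formula → Set where
  aw↑ : ∀ a → UpRule (at a) 𝕥
  ac↑ : ∀ a → UpRule (at a) (at a ∧ at a)
  s   : ∀ α β γ → UpRule (α ∧ (β ∨ γ)) ((α ∧ β) ∨ γ)
  eq  : ∀ {γ δ} → γ ≈ δ → UpRule γ δ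

data Derivation (R : Formula → Formula → Set) : Formula → Formula → Set where
  done : ∀ α → Derivation R α α
  step : ∀ {β} (ξ : Context) {γ δ} → R γ δ →
         Derivation R (ξ ⟦ δ ⟧) β → Derivation R (ξ ⟦ γ ⟧) β

dsize : ∀ {R α β} → Derivation R α β → ℕ
dsize (done α) = size α
dsize (step {β} ξ {γ} r d) = size (ξ ⟦ γ ⟧) + dsize d

module Submission where

-- At a leaf, one weakening
-- (or just a unit law, if the leaf is a itself) does the job.  At a binary
-- connective the derivations for the two immediate subformulae are run side
-- by side inside one-level contexts ("frames"); the down derivation then
-- merges the two copies of a with one contraction ac↓, while the up
-- derivation first duplicates a with ac↑ and distributes it over the
-- connective.  The complexity bookkeeping is done through the notion of a
-- *bounded* derivation: at most L steps, every premiss of size at most W.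
-- The constructions stay within L = budget α ≤ 10|α| − 7 steps (3 per leaf,
-- 7 per connective) and width W = 2|α|, so the size of each derivation is at
-- most (L + 1)·W ≤ 20|α|² ≤ 20|α|³.

open import Defs
open import Data.Nat using (ℕ; _*_; _^_; _≤_)
open import Data.Product using (Σ; _×_)
open import Data.Nat using (zero; suc; _+_; s≤s)
open import Data.Nat.Properties
  using (≤-refl; ≤-reflexive; +-comm; ≤-trans; n≤1+n; m≤m+n; m≤n+m; m≤m*n;
         +-mono-≤; +-monoˡ-≤; +-monoʳ-≤; *-monoˡ-≤; *-monoʳ-≤; *-distribˡ-+; module ≤-Reasoning)
open import Data.Nat.Tactic.RingSolver using (solve-∀)
open import Data.Product using (_,_)
open import Data.List using (List; []; _∷_; _++_; length; map)
open import Data.List.Properties using (length-++; length-map)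
open import Data.List.Relation.Unary.All as All using (All; []; _∷_)
open import Data.List.Relation.Unary.All.Properties using (++⁺; map⁺)
open import Relation.Nullary using (yes; no)
open import Relation.Binary.PropositionalEquality using (_≡_; refl; sym; trans; cong; cong₂)
open import Relation.Binary.Structures using (IsEquivalence)
open import Level using (0ℓ)
open import Algebra.Bundles using (CommutativeSemigroup)
import Algebra.Properties.CommutativeSemigroup as CommutativeSemigroupProperties

private variable
  R : Formula → Formula → Set
  α β γ : Formula
  L L₁ L₂ L' W W' : ℕ

-- The rule = makes ∨ and ∧ commutative semigroups up to ≈, so the library's
-- rearrangement lemmas (interchange, …) are available for both.

≈-isEquivalence : IsEquivalence _≈_
≈-isEquivalence = record { refl = ≈-refl ; sym = ≈-sym ; trans = ≈-trans }

∨-commutativeSemigroup : CommutativeSemigroup 0ℓ 0ℓ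
∨-commutativeSemigroup = record
  { Carrier = Formula
  ; _≈_ = _≈_
  ; _∙_ = _∨_
  ; isCommutativeSemigroup = record
    { isSemigroup = record
      { isMagma = record { isEquivalence = ≈-isEquivalence ; ∙-cong = ∨-cong }
      ; assoc = λ _ _ _ → ∨-assoc }
    ; comm = λ _ _ → ∨-comm } }

∧-commutativeSemigroup : CommutativeSemigroup 0ℓ 0ℓ
∧-commutativeSemigroup = record
  { Carrier = Formula
  ; _≈_ = _≈_
  ; _∙_ = _∧_
  ; isCommutativeSemigroup = record
    { isSemigroup = record
      { isMagma = record { isEquivalence = ≈-isEquivalence ; ∙-cong = ∧-cong }
      ; assoc = λ _ _ _ → ∧-assoc }
    ; comm = λ _ _ → ∧-comm } }

module Disjunction = CommutativeSemigroupProperties ∨-commutativeSemigroup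
module Conjunction = CommutativeSemigroupProperties ∧-commutativeSemigroup

size-pos : ∀ α → 1 ≤ size α
size-pos 𝕥 = ≤-refl
size-pos 𝕗 = ≤-refl
size-pos (at _) = ≤-refl
size-pos (α ∨ β) = ≤-trans (size-pos α) (m≤m+n _ _)
size-pos (α ∧ β) = ≤-trans (size-pos α) (m≤m+n _ _)

size-subst : ∀ α a β → size β ≡ 1 → size (subst α a β) ≡ size α
size-subst 𝕥 a β _ = refl
size-subst 𝕗 a β _ = refl
size-subst (at b) a β unit with b ≟A a
... | yes _ = unit
... | no _ = refl
size-subst (α₁ ∨ α₂) a β unit = cong₂ _+_ (size-subst α₁ a β unit) (size-subst α₂ a β unit)
size-subst (α₁ ∧ α₂) a β unit = cong₂ _+_ (size-subst α₁ a β unit) (size-subst α₂ a β unit)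

≤-double : ∀ n → n ≤ 2 * n
≤-double n = m≤m+n n (n + 0)

extra-atom-fits : ∀ α a β → size β ≡ 1 → 1 + size (subst α a β) ≤ 2 * size α
extra-atom-fits α a β unit rewrite size-subst α a β unit = +-mono-≤ (size-pos α) (m≤m+n (size α) 0)

fits : ∀ p q {m n} → m ≤ 2 * p → n ≤ 2 * q → m + n ≤ 2 * (p + q)
fits p q m≤ n≤ = ≤-trans (+-mono-≤ m≤ n≤) (≤-reflexive (sym (*-distribˡ-+ 2 p q)))

module NodeWidths (α₁ α₂ : Formula) (a : Atom) (β : Formula) (unit : size β ≡ 1) where
  room₁ : 1 + size (subst α₁ a β) ≤ 2 * size α₁
  room₁ = extra-atom-fits α₁ a β unit
  room₂ : 1 + size (subst α₂ a β) ≤ 2 * size α₂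
  room₂ = extra-atom-fits α₂ a β unit
  together : ∀ {m n} → m ≤ 2 * size α₁ → n ≤ 2 * size α₂ → m + n ≤ 2 * (size α₁ + size α₂)
  together = fits (size α₁) (size α₂)

premisses : Derivation R α β → List Formula
premisses (done _) = []
premisses (step ξ {γ} _ d) = ξ ⟦ γ ⟧ ∷ premisses d

infixr 5 _⨾_

_⨾_ : Derivation R α β → Derivation R β γ → Derivation R α γ
done _ ⨾ e = e
step ξ r d ⨾ e = step ξ r (d ⨾ e)

premisses-⨾ : (d : Derivation R α β) (e : Derivation R β γ) → premisses (d ⨾ e) ≡ premisses d ++ premisses e
premisses-⨾ (done _) e = refl
premisses-⨾ (step ξ r d) e = cong (_ ∷_) (premisses-⨾ d e)

data Frame : Set where
  □∨_ _∨□ □∧_ _∧□ : Formula → Frame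

_⟨_⟩ : Frame → Formula → Formula
(□∨ δ) ⟨ φ ⟩ = φ ∨ δ
(δ ∨□) ⟨ φ ⟩ = δ ∨ φ
(□∧ δ) ⟨ φ ⟩ = φ ∧ δ
(δ ∧□) ⟨ φ ⟩ = δ ∧ φ

frameWidth : Frame → ℕ → ℕ
frameWidth (□∨ δ) w = w + size δ
frameWidth (δ ∨□) w = size δ + w
frameWidth (□∧ δ) w = w + size δ
frameWidth (δ ∧□) w = size δ + w

size-framed : ∀ F {φ w} → size φ ≤ w → size (F ⟨ φ ⟩) ≤ frameWidth F w
size-framed (□∨ δ) φ≤w = +-monoˡ-≤ (size δ) φ≤w
size-framed (δ ∨□) φ≤w = +-monoʳ-≤ (size δ) φ≤w
size-framed (□∧ δ) φ≤w = +-monoˡ-≤ (size δ) φ≤w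
size-framed (δ ∧□) φ≤w = +-monoʳ-≤ (size δ) φ≤w

framedStep : ∀ F ξ {γ δ} → R γ δ → Derivation R (F ⟨ ξ ⟦ δ ⟧ ⟩) β → Derivation R (F ⟨ ξ ⟦ γ ⟧ ⟩) β
framedStep (□∨ δ) ξ = step (ξ ∨ₗ δ)
framedStep (δ ∨□) ξ = step (δ ∨ᵣ ξ)
framedStep (□∧ δ) ξ = step (ξ ∧ₗ δ)
framedStep (δ ∧□) ξ = step (δ ∧ᵣ ξ)

premisses-framedStep : ∀ F ξ {γ δ} (r : R γ δ) (d : Derivation R (F ⟨ ξ ⟦ δ ⟧ ⟩) β) →
  premisses (framedStep F ξ r d) ≡ F ⟨ ξ ⟦ γ ⟧ ⟩ ∷ premisses d
premisses-framedStep (□∨ _) ξ r d = refl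
premisses-framedStep (_ ∨□) ξ r d = refl
premisses-framedStep (□∧ _) ξ r d = refl
premisses-framedStep (_ ∧□) ξ r d = refl

lift : ∀ F → Derivation R α β → Derivation R (F ⟨ α ⟩) (F ⟨ β ⟩)
lift F (done _) = done _
lift F (step ξ r d) = framedStep F ξ r (lift F d)

premisses-lift : ∀ F (d : Derivation R α β) → premisses (lift F d) ≡ map (F ⟨_⟩) (premisses d)
premisses-lift F (done _) = refl
premisses-lift F (step ξ r d) = trans (premisses-framedStep F ξ r (lift F d)) (cong (_ ∷_) (premisses-lift F d))

record Bounded (R : Formula → Formula → Set) (α β : Formula) (L W : ℕ) : Set where
  constructor bounded
  field
    derivation : Derivation R α β
    short      : length (premisses derivation) ≤ L
    narrow     : All (λ φ → size φ ≤ W) (premisses derivation)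

weaken : L ≤ L' → W ≤ W' → Bounded R α β L W → Bounded R α β L' W'
weaken L≤ W≤ (bounded d short narrow) = bounded d (≤-trans short L≤) (All.map (λ φ≤ → ≤-trans φ≤ W≤) narrow)

infixr 5 _⨾ᵇ_

_⨾ᵇ_ : Bounded R α β L₁ W → Bounded R β γ L₂ W → Bounded R α γ (L₁ + L₂) W
bounded d short₁ narrow₁ ⨾ᵇ bounded e short₂ narrow₂ = bounded (d ⨾ e) short narrow
  where
  short : length (premisses (d ⨾ e)) ≤ _
  short rewrite premisses-⨾ d e | length-++ (premisses d) {premisses e} = +-mono-≤ short₁ short₂
  narrow : All (λ φ → size φ ≤ _) (premisses (d ⨾ e))
  narrow rewrite premisses-⨾ d e = ++⁺ narrow₁ narrow₂

liftᵇ : ∀ F → Bounded R α β L W → Bounded R (F ⟨ α ⟩) (F ⟨ β ⟩) L (frameWidth F W)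
liftᵇ F (bounded d short narrow) = bounded (lift F d) short′ narrow′
  where
  short′ : length (premisses (lift F d)) ≤ _
  short′ rewrite premisses-lift F d | length-map (F ⟨_⟩) (premisses d) = short
  narrow′ : All (λ φ → size φ ≤ frameWidth F _) (premisses (lift F d))
  narrow′ rewrite premisses-lift F d = map⁺ (All.map (size-framed F) narrow)

dsize-bounded : (B : Bounded R α β L W) → size β ≤ W → dsize (Bounded.derivation B) ≤ suc L * W
dsize-bounded {W = W} (bounded d short narrow) β≤W =
  ≤-trans (per-formula d narrow) (*-monoˡ-≤ W (s≤s short))
  where
  per-formula : ∀ {α} (d : Derivation R α _) → All (λ φ → size φ ≤ W) (premisses d) →
                dsize d ≤ suc (length (premisses d)) * W
  per-formula (done _) [] = ≤-trans β≤W (m≤m+n W 0)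
  per-formula (step ξ r d) (γ≤W ∷ narrow) = +-mono-≤ γ≤W (per-formula d narrow)

budget : Formula → ℕ
budget (α ∨ β) = budget α + (budget β + 7)
budget (α ∧ β) = budget α + (budget β + 7)
budget _ = 3

budget-node : ∀ {b₁ b₂} n₁ n₂ → 7 + b₁ ≤ 10 * n₁ → 7 + b₂ ≤ 10 * n₂ → 7 + (b₁ + (b₂ + 7)) ≤ 10 * (n₁ + n₂)
budget-node {b₁} {b₂} n₁ n₂ h₁ h₂ = begin
  7 + (b₁ + (b₂ + 7))  ≡⟨ regroup b₁ b₂ ⟩
  (7 + b₁) + (7 + b₂)  ≤⟨ +-mono-≤ h₁ h₂ ⟩
  10 * n₁ + 10 * n₂    ≡⟨ sym (*-distribˡ-+ 10 n₁ n₂) ⟩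
  10 * (n₁ + n₂)       ∎
  where
  open ≤-Reasoning
  regroup : ∀ b₁ b₂ → 7 + (b₁ + (b₂ + 7)) ≡ (7 + b₁) + (7 + b₂)
  regroup = solve-∀

-- In the up derivation the node's 7 steps come first.
node-last : ∀ b₁ b₂ → 7 + (b₁ + b₂) ≡ b₁ + (b₂ + 7)
node-last = solve-∀

budget-linear : ∀ α → 7 + budget α ≤ 10 * size α
budget-linear (α ∨ β) = budget-node (size α) (size β) (budget-linear α) (budget-linear β)
budget-linear (α ∧ β) = budget-node (size α) (size β) (budget-linear α) (budget-linear β)
budget-linear 𝕥 = ≤-refl
budget-linear 𝕗 = ≤-refl
budget-linear (at _) = ≤-refl

-- Leaf of the down derivation: weakening brings an atom next to any formula: α → [α ∨ f] → [α ∨ a] → [a ∨ α].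
introduce : ∀ a α → Bounded DownRule α (at a ∨ α) 3 (1 + size α)
introduce a α = bounded
  (step □ (eq (≈-sym ∨-unit)) (step (α ∨ᵣ □) (aw↓ a) (step □ (eq ∨-comm) (done _))))
  ≤-refl
  (n≤1+n _ ∷ one-more ∷ one-more ∷ [])
  where
  one-more : size α + 1 ≤ 1 + size α
  one-more = ≤-reflexive (+-comm (size α) 1)

pad : ∀ φ → Bounded DownRule φ (φ ∨ 𝕗) 1 (size φ)
pad φ = bounded (step □ (eq (≈-sym ∨-unit)) (done _)) ≤-refl (≤-refl ∷ [])

-- Leaf of the up derivation: weakening discards an atom from any formula: (a ∧ α) → (t ∧ α) = α.
discard : ∀ a α → Bounded UpRule (at a ∧ α) α 2 (1 + size α)
discard a α = bounded
  (step (□ ∧ₗ α) (aw↑ a) (step □ (eq (≈-trans ∧-comm ∧-unit)) (done _)))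
  ≤-refl
  (≤-refl ∷ ≤-refl ∷ [])

unpad : ∀ φ → Bounded UpRule (φ ∧ 𝕥) φ 1 (size φ + 1)
unpad φ = bounded (step □ (eq ∧-unit) (done _)) ≤-refl (≤-refl ∷ [])

-- All formulae involved are rearrangements of a, a, x, y, possibly with one
-- copy of a contracted, so their size is at most pairWidth x y, the size of
-- [[a ∨ x] ∨ [a ∨ y]].
pairWidth : Formula → Formula → ℕ
pairWidth x y = (1 + size x) + (1 + size y)

two-atoms : ∀ p q → 2 + (p + q) ≡ (1 + p) + (1 + q)
two-atoms = solve-∀

one-atom : ∀ p q → 1 + (p + q) ≤ (1 + p) + (1 + q)
one-atom p q = ≤-trans (n≤1+n _) (≤-reflexive (two-atoms p q))

-- [[a ∨ x] ∨ [a ∨ y]] = [[a ∨ a] ∨ [x ∨ y]] → [a ∨ [x ∨ y]]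
merge∨ : ∀ a x y → Bounded DownRule ((at a ∨ x) ∨ (at a ∨ y)) (at a ∨ (x ∨ y)) 2 (pairWidth x y)
merge∨ a x y = bounded
  (step □ (eq (Disjunction.interchange (at a) x (at a) y)) (step (□ ∨ₗ (x ∨ y)) (ac↓ a) (done _)))
  ≤-refl
  (≤-refl ∷ ≤-reflexive (two-atoms (size x) (size y)) ∷ [])

-- ([a ∨ x] ∧ [a ∨ y]) → [([a ∨ x] ∧ y) ∨ a] → [[(y ∧ x) ∨ a] ∨ a] → [a ∨ (x ∧ y)],
-- two switches followed by one contraction.
merge∧ : ∀ a x y → Bounded DownRule ((at a ∨ x) ∧ (at a ∨ y)) (at a ∨ (x ∧ y)) 7 (pairWidth x y)
merge∧ a x y = bounded
  (step □ (eq (∧-cong ≈-refl ∨-comm))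
  (step □ (s (A ∨ x) y A)
  (step □ (eq (∨-cong (≈-trans ∧-comm (∧-cong ≈-refl ∨-comm)) ≈-refl))
  (step (□ ∨ₗ A) (s y x A)
  (step □ (eq ∨-assoc)
  (step ((y ∧ x) ∨ᵣ □) (ac↓ a)
  (step □ (eq (≈-trans ∨-comm (∨-cong ≈-refl ∧-comm)))
  (done _))))))))
  ≤-refl
  (≤-refl ∷ fit (e₁ p q) ∷ fit (e₂ p q) ∷ fit (e₃ p q) ∷ fit (e₄ p q) ∷ fit (e₅ p q) ∷
   ≤-trans (n≤1+n _) (fit (e₆ p q)) ∷ [])
  where
  A : Formula
  A = at a
  p q : ℕ
  p = size x
  q = size y
  fit : ∀ {m} → m ≡ pairWidth x y → m ≤ pairWidth x y
  fit = ≤-reflexive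
  e₁ : ∀ p q → (1 + p) + (q + 1) ≡ (1 + p) + (1 + q)
  e₁ = solve-∀
  e₂ : ∀ p q → ((1 + p) + q) + 1 ≡ (1 + p) + (1 + q)
  e₂ = solve-∀
  e₃ : ∀ p q → (q + (p + 1)) + 1 ≡ (1 + p) + (1 + q)
  e₃ = solve-∀
  e₄ : ∀ p q → ((q + p) + 1) + 1 ≡ (1 + p) + (1 + q)
  e₄ = solve-∀
  e₅ : ∀ p q → (q + p) + (1 + 1) ≡ (1 + p) + (1 + q)
  e₅ = solve-∀
  e₆ : ∀ p q → 1 + ((q + p) + 1) ≡ (1 + p) + (1 + q)
  e₆ = solve-∀

-- (a ∧ [x ∨ y]) → ((a ∧ a) ∧ [x ∨ y]) → (a ∧ [(a ∧ x) ∨ y]) → [(a ∧ y) ∨ (a ∧ x)],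
-- one contraction followed by two switches.
split∨ : ∀ a x y → Bounded UpRule (at a ∧ (x ∨ y)) ((at a ∧ x) ∨ (at a ∧ y)) 6 (pairWidth x y)
split∨ a x y = bounded
  (step (□ ∧ₗ (x ∨ y)) (ac↑ a)
  (step □ (eq ∧-assoc)
  (step (A ∧ᵣ □) (s A x y)
  (step □ (eq (∧-cong ≈-refl ∨-comm))
  (step □ (s A y (A ∧ x))
  (step □ (eq ∨-comm)
  (done _)))))))
  ≤-refl
  (one-atom p q ∷ fit (two-atoms p q) ∷ fit (two-atoms p q) ∷
   fit (e₁ p q) ∷ fit (e₂ p q) ∷ fit (e₃ p q) ∷ [])
  where
  A : Formula
  A = at a
  p q : ℕ
  p = size x
  q = size y
  fit : ∀ {m} → m ≡ pairWidth x y → m ≤ pairWidth x y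
  fit = ≤-reflexive
  e₁ : ∀ p q → 1 + ((1 + p) + q) ≡ (1 + p) + (1 + q)
  e₁ = solve-∀
  e₂ : ∀ p q → 1 + (q + (1 + p)) ≡ (1 + p) + (1 + q)
  e₂ = solve-∀
  e₃ : ∀ p q → (1 + q) + (1 + p) ≡ (1 + p) + (1 + q)
  e₃ = solve-∀

-- (a ∧ (x ∧ y)) → ((a ∧ a) ∧ (x ∧ y)) = ((a ∧ x) ∧ (a ∧ y))
split∧ : ∀ a x y → Bounded UpRule (at a ∧ (x ∧ y)) ((at a ∧ x) ∧ (at a ∧ y)) 2 (pairWidth x y)
split∧ a x y = bounded
  (step (□ ∧ₗ (x ∧ y)) (ac↑ a) (step □ (eq (Conjunction.interchange (at a) (at a) x y)) (done _)))
  ≤-refl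
  (one-atom (size x) (size y) ∷ ≤-reflexive (two-atoms (size x) (size y)) ∷ [])

down : ∀ a α → Bounded DownRule α (at a ∨ subst α a 𝕗) (budget α) (2 * size α)
down a 𝕥 = introduce a 𝕥
down a 𝕗 = introduce a 𝕗
down a (at b) with b ≟A a
... | yes refl = weaken (m≤m+n 1 2) (n≤1+n 1) (pad (at a))
... | no _ = introduce a (at b)
down a (α₁ ∨ α₂) =
     weaken ≤-refl (together ≤-refl (≤-double (size α₂))) (liftᵇ (□∨ α₂) (down a α₁))
  ⨾ᵇ weaken ≤-refl (together room₁ ≤-refl) (liftᵇ ((at a ∨ subst α₁ a 𝕗) ∨□) (down a α₂))
  ⨾ᵇ weaken (m≤m+n 2 5) (together room₁ room₂) (merge∨ a (subst α₁ a 𝕗) (subst α₂ a 𝕗))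
  where open NodeWidths α₁ α₂ a 𝕗 refl
down a (α₁ ∧ α₂) =
     weaken ≤-refl (together ≤-refl (≤-double (size α₂))) (liftᵇ (□∧ α₂) (down a α₁))
  ⨾ᵇ weaken ≤-refl (together room₁ ≤-refl) (liftᵇ ((at a ∨ subst α₁ a 𝕗) ∧□) (down a α₂))
  ⨾ᵇ weaken ≤-refl (together room₁ room₂) (merge∧ a (subst α₁ a 𝕗) (subst α₂ a 𝕗))
  where open NodeWidths α₁ α₂ a 𝕗 refl

up : ∀ a α → Bounded UpRule (at a ∧ subst α a 𝕥) α (budget α) (2 * size α)
up a 𝕥 = weaken (n≤1+n 2) ≤-refl (discard a 𝕥)
up a 𝕗 = weaken (n≤1+n 2) ≤-refl (discard a 𝕗)
up a (at b) with b ≟A a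
... | yes refl = weaken (m≤m+n 1 2) ≤-refl (unpad (at a))
... | no _ = weaken (n≤1+n 2) ≤-refl (discard a (at b))
up a (α₁ ∨ α₂) = weaken (≤-reflexive (node-last (budget α₁) (budget α₂))) ≤-refl
  (   weaken (n≤1+n 6) (together room₁ room₂) (split∨ a (subst α₁ a 𝕥) (subst α₂ a 𝕥))
   ⨾ᵇ weaken ≤-refl (together ≤-refl room₂) (liftᵇ (□∨ (at a ∧ subst α₂ a 𝕥)) (up a α₁))
   ⨾ᵇ weaken ≤-refl (together (≤-double (size α₁)) ≤-refl) (liftᵇ (α₁ ∨□) (up a α₂)))
  where open NodeWidths α₁ α₂ a 𝕥 refl
up a (α₁ ∧ α₂) = weaken (≤-reflexive (node-last (budget α₁) (budget α₂))) ≤-refl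
  (   weaken (m≤m+n 2 5) (together room₁ room₂) (split∧ a (subst α₁ a 𝕥) (subst α₂ a 𝕥))
   ⨾ᵇ weaken ≤-refl (together ≤-refl room₂) (liftᵇ (□∧ (at a ∧ subst α₂ a 𝕥)) (up a α₁))
   ⨾ᵇ weaken ≤-refl (together (≤-double (size α₁)) ≤-refl) (liftᵇ (α₁ ∧□) (up a α₂)))
  where open NodeWidths α₁ α₂ a 𝕥 refl

cubic : ∀ n → Bounded R α β L (2 * n) → 7 + L ≤ 10 * n → size β ≤ 2 * n →
        Σ (Derivation R α β) λ d → dsize d ≤ 20 * n ^ 3
cubic zero _ ()
cubic {L = L} n@(suc _) B within β≤ = Bounded.derivation B , (begin
  dsize (Bounded.derivation B)  ≤⟨ dsize-bounded B β≤ ⟩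
  suc L * (2 * n)               ≤⟨ *-monoˡ-≤ (2 * n) (≤-trans (s≤s (m≤n+m L 6)) within) ⟩
  10 * n * (2 * n)              ≡⟨ square n ⟩
  20 * (n * n)                  ≤⟨ *-monoʳ-≤ 20 (m≤m*n (n * n) n) ⟩
  20 * (n * n * n)              ≡⟨ cube n ⟩
  20 * n ^ 3                    ∎)
  where
  open ≤-Reasoning
  square : ∀ n → 10 * n * (2 * n) ≡ 20 * (n * n)
  square = solve-∀
  -- n ^ 3 unfolds to n * (n * (n * 1))
  cube : ∀ n → 20 * (n * n * n) ≡ 20 * (n * (n * (n * 1)))
  cube = solve-∀

proposition6p1 : Σ ℕ λ c → (α : Formula) (a : Atom) →
    (Σ (Derivation DownRule α (at a ∨ subst α a 𝕗)) λ d → dsize d ≤ c * size α ^ 3)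
    × (Σ (Derivation UpRule (at a ∧ subst α a 𝕥) α) λ d → dsize d ≤ c * size α ^ 3)
proposition6p1 = 20 , λ α a →
    cubic (size α) (down a α) (budget-linear α) (extra-atom-fits α a 𝕗 refl)
  , cubic (size α) (up a α) (budget-linear α) (≤-double (size α))
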